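{- Let $G$ be a finite simple graph and let $r\ge 2$ be an integer. For each vertex $v\in V(G)$ let $G_v$ be the graph with vertex set $(V(G)\setminus\{v\})\cup\{v_1,\dots,v_r\}$ (new vertices $v_1,\dots,v_r$) and edge set $E(G-v)\cup\{v_iv_j: 1\le i<j\le r\}\cup\{wv_i: w\in N(v),\ 1\le i\le r\}$, where $N(v)$ is the neighborhood of $v$ in $G$. Then for every positive integer $k$, $$\pi_G^{(K_r)}(k) = \frac{1}{r!}\sum_{v\in V(G)} \pi_{G_v}(k).$$
   Context: $K_r$ is the complete graph on $r$ vertices. For a positive integer $k$, a proper $k$-coloring of $G$ is a map $V(G)\to\{1,\dots,k\}$ giving adjacent vertices different colors; $\pi_G(k)$ is the number of proper $k$-colorings. The $k$-coloring graph $\mathcal{C}_k(G)$ has the proper $k$-colorings of $G$ as vertices, two colorings adjacent iff they differ in the color of exactly one vertex. For a graph $H$, $\pi_G^{(H)}(k)$ is the number of vertex subsets $U$ of $\mathcal{C}_k(G)$ whose induced subgraph $\mathcal{C}_k(G)[U]$ is isomorphic to $H$. -}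

module Defs where

open import Data.Bool using (Bool; true; false; _∧_; _∨_; not; if_then_else_)
open import Data.Nat using (ℕ; zero; suc; _+_; _≡ᵇ_)
open import Data.Fin using (Fin; zero; suc; punchIn; splitAt)
open import Data.Fin.Properties using (_≟_)
open import Data.Sum using (inj₁; inj₂)
open import Data.Vec using (Vec; []; _∷_; lookup)
open import Data.List using (List; []; _∷_; [_]; map; concatMap; length; filterᵇ; allFin)
open import Data.Bool.ListAction using (and; or)
open import Relation.Nullary.Decidable using (⌊_⌋)
open import Relation.Binary.PropositionalEquality using (_≡_)

-- A (finite simple) graph on vertex set Fin n is given by a Boolean adjacency
-- relation; simplicity (symmetry, irreflexivity) is imposed as hypotheses.
Adj : ℕ → Set
Adj n = Fin n → Fin n → Bool

Symmetric : ∀ {n} → Adj n → Set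
Symmetric {n} a = ∀ (i j : Fin n) → a i j ≡ a j i

Irreflexive : ∀ {n} → Adj n → Set
Irreflexive {n} a = ∀ (i : Fin n) → a i i ≡ false

_==_ : ∀ {n} → Fin n → Fin n → Bool
i == j = ⌊ i ≟ j ⌋

allVecs : ∀ {A : Set} → List A → (n : ℕ) → List (Vec A n)
allVecs xs zero = [ [] ]
allVecs xs (suc n) = concatMap (λ x → map (x ∷_) (allVecs xs n)) xs

allMaps : (n k : ℕ) → List (Vec (Fin k) n)
allMaps n k = allVecs (allFin k) n

allᶠ : ∀ n → (Fin n → Bool) → Bool
allᶠ n p = and (map p (allFin n))

anyᶠ : ∀ n → (Fin n → Bool) → Bool
anyᶠ n p = or (map p (allFin n))

_⇒ᵇ_ : Bool → Bool → Bool
a ⇒ᵇ b = not a ∨ b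

_⇔ᵇ_ : Bool → Bool → Bool
a ⇔ᵇ b = (a ⇒ᵇ b) ∧ (b ⇒ᵇ a)

isProper : ∀ {n k} → Adj n → Vec (Fin k) n → Bool
isProper {n} a c = allᶠ n λ i → allᶠ n λ j → a i j ⇒ᵇ not (lookup c i == lookup c j)

properColorings : ∀ {n} → Adj n → (k : ℕ) → List (Vec (Fin k) n)
properColorings {n} a k = filterᵇ (isProper a) (allMaps n k)

chrom : ∀ {n} → Adj n → ℕ → ℕ
chrom a k = length (properColorings a k)

differInOne : ∀ {n k} → Vec (Fin k) n → Vec (Fin k) n → Bool
differInOne {n} c c' =
  length (filterᵇ (λ i → not (lookup c i == lookup c' i)) (allFin n)) ≡ᵇ 1

-- the k-coloring graph C_k(G): vertices Fin (π_G(k)) indexing the proper colorings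
colGraph : ∀ {n} → (a : Adj n) → (k : ℕ) → Adj (chrom a k)
colGraph a k x y =
  differInOne (Data.List.lookup (properColorings a k) x)
              (Data.List.lookup (properColorings a k) y)

allSubsets : (N : ℕ) → List (Vec Bool N)
allSubsets N = allVecs (true ∷ false ∷ []) N

-- G[U] ≅ H (H on vertex set Fin m): there is a map f : V(H) → V(G), injective,
-- with image exactly U, such that ij ∈ E(H) ⇔ f(i)f(j) ∈ E(G).
inducedIso : ∀ {N m} → Adj N → Adj m → Vec Bool N → Bool
inducedIso {N} {m} g h U = anyᶠ′ (allVecs (allFin N) m)
  where
  anyᶠ′ : List (Vec (Fin N) m) → Bool
  anyᶠ′ fs = or (map ok fs)
    where
    ok : Vec (Fin N) m → Bool
    ok f =  (allᶠ m λ i → allᶠ m λ j → (lookup f i == lookup f j) ⇒ᵇ (i == j))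
         ∧ (allᶠ N λ x → lookup U x ⇔ᵇ anyᶠ m (λ i → lookup f i == x))
         ∧ (allᶠ m λ i → allᶠ m λ j → h i j ⇔ᵇ g (lookup f i) (lookup f j))

inducedCount : ∀ {N m} → Adj N → Adj m → ℕ
inducedCount {N} g h = length (filterᵇ (inducedIso g h) (allSubsets N))

chromH : ∀ {n m} → Adj n → Adj m → ℕ → ℕ
chromH a h k = inducedCount (colGraph a k) h

K : (r : ℕ) → Adj r
K r i j = not (i == j)

-- G_v : delete v, add r pairwise adjacent clones v_1..v_r each adjacent to N(v).
-- Vertex set Fin (n' + r): the first n' vertices are V(G) ∖ {v} (via punchIn v),
-- the last r are the clones.
GvSize : ∀ {n} → Fin n → ℕ → ℕ
GvSize {suc n'} _ r = n' + r

Gv : ∀ {n} → Adj n → (v : Fin n) → (r : ℕ) → Adj (GvSize v r)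
Gv {suc n'} a v r x y with splitAt n' x | splitAt n' y
... | inj₁ i | inj₁ j = a (punchIn v i) (punchIn v j)
... | inj₁ i | inj₂ _ = a (punchIn v i) v
... | inj₂ _ | inj₁ j = a v (punchIn v j)
... | inj₂ i | inj₂ j = not (i == j)

{-# OPTIONS --safe #-}
-- Double count the ordered r-tuples of distinct, pairwise adjacent vertices of C_k(G). Grouped by
-- the set they list, each induced K_r contributes r! of them. Grouped instead by the vertex v at
-- which the first two colorings of the tuple differ: a coloring at distance one from two colorings
-- that differ only at v can itself differ from them only at v, so all r colorings agree off v, and
-- the tuple amounts to a coloring of G - v together with r distinct colors for v, each compatible
-- with N(v); that is, to a proper k-coloring of G_v.
module Submission where

open import Defs
open import Data.Bool using (Bool; true; false; T; T?; not; _∧_)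
open import Data.Bool.ListAction using (and; or)
open import Data.Bool.Properties using (T-∧)
open import Data.Empty using (⊥-elim)
open import Data.Fin using (Fin; zero; suc; punchIn; splitAt; join)
open import Data.Fin.Properties
  using (_≟_; 0≢1+n; suc-injective; punchInᵢ≢i; punchIn-punchOut; punchOut-punchIn; splitAt-join)
import Data.List as List
open import Data.List using (List; []; _∷_; [_]; map; allFin; concatMap; filterᵇ; length; cartesianProductWith)
open import Data.List.Membership.Propositional using (_∈_; lose)
open import Data.List.Membership.Propositional.Properties
  using (∈-filter⁺; ∈-filter⁻; ∈-map⁺; ∈-map⁻; ∈-cartesianProductWith⁺; ∈-allFin; ∈-lookup)
open import Data.List.Membership.Propositional.Properties.WithK using (unique∧set⇒bag)
open import Data.List.Properties
  using (filter-all; filter-none; filter-++; length-++; length-map; length-tabulate; map-cong)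
open import Data.List.Relation.Binary.BagAndSetEquality using (∼bag⇒↭)
open import Data.List.Relation.Binary.Permutation.Propositional.Properties using (↭-length)
open import Data.List.Relation.Unary.All as All using (All; []; _∷_)
import Data.List.Relation.Unary.All.Properties as All
open import Data.List.Relation.Unary.Any as Any using (Any; here; there)
open import Data.List.Relation.Unary.Any.Properties using (lookup-index)
open import Data.List.Relation.Unary.AllPairs using ([]; _∷_)
open import Data.List.Relation.Unary.Unique.Propositional using (Unique)
import Data.List.Relation.Unary.Unique.Propositional.Properties as Unique
open import Data.Nat using (ℕ; zero; suc; _+_; _*_; _!; _≡ᵇ_; _≤_; s≤s)
open import Data.Nat.ListAction using (sum)
open import Data.Nat.Properties using (+-identityʳ; *-comm; *-distribʳ-+; ≡ᵇ⇒≡; ≡⇒≡ᵇ)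
import Data.Nat.Properties as ℕ
open import Algebra.Properties.CommutativeSemigroup ℕ.+-commutativeSemigroup using (interchange)
open import Data.Product using (∃; _×_; _,_; proj₁; proj₂)
open import Data.Sum using (_⊎_; inj₁; inj₂; [_,_]′)
open import Data.Vec using (Vec; []; _∷_; _++_; lookup; tabulate; insertAt; removeAt)
import Data.Vec as Vec
open import Data.Vec.Properties
  using ( lookup∘tabulate; tabulate∘lookup; tabulate-cong; ∷-injective; ++-injective; lookup-map; lookup-splitAt
        ; insertAt-lookup; insertAt-punchIn; removeAt-punchOut; removeAt-insertAt)
open import Function using (_∘_; _⇔_; mk⇔; Equivalence; Injective)
open import Relation.Binary.PropositionalEquality
  using (_≡_; _≢_; _≗_; refl; sym; trans; cong; cong₂; subst; subst₂; module ≡-Reasoning)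
open import Relation.Nullary using (¬_; Dec; yes; no)
open import Relation.Nullary.Decidable
  using (toWitness; fromWitness; toWitnessFalse; fromWitnessFalse; decidable-stable)

open Equivalence using (to; from)

private variable
  A B : Set
  m n : ℕ
  x y : Bool

T-injective : (T x → T y) → (T y → T x) → x ≡ y
T-injective {false} {false} _ _ = refl
T-injective {false} {true}  _ g = ⊥-elim (g _)
T-injective {true}  {false} f _ = ⊥-elim (f _)
T-injective {true}  {true}  _ _ = refl

T-⇒ᵇ : T (x ⇒ᵇ y) ⇔ (T x → T y)
T-⇒ᵇ {false} = mk⇔ (λ _ ()) (λ _ → _)
T-⇒ᵇ {true}  = mk⇔ (λ t _ → t) (λ f → f _)

T-⇔ᵇ : T (x ⇔ᵇ y) ⇔ (x ≡ y)
T-⇔ᵇ {false} {false} = mk⇔ (λ _ → refl) (λ _ → _)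
T-⇔ᵇ {false} {true}  = mk⇔ (λ ()) (λ ())
T-⇔ᵇ {true}  {false} = mk⇔ (λ ()) (λ ())
T-⇔ᵇ {true}  {true}  = mk⇔ (λ _ → refl) (λ _ → _)

T-== : {i j : Fin n} → T (i == j) ⇔ (i ≡ j)
T-== = mk⇔ toWitness fromWitness

T-not== : {i j : Fin n} → T (not (i == j)) ⇔ (i ≢ j)
T-not== = mk⇔ toWitnessFalse fromWitnessFalse

T-and : (p : A → Bool) (xs : List A) → T (and (map p xs)) ⇔ All (T ∘ p) xs
T-and p [] = mk⇔ (λ _ → []) (λ _ → _)
T-and p (x ∷ xs) = mk⇔
  (λ t → let px , pxs = to T-∧ t in px ∷ to (T-and p xs) pxs)
  (λ { (px ∷ pxs) → from T-∧ (px , from (T-and p xs) pxs) })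

T-or : (p : A → Bool) (xs : List A) → T (or (map p xs)) ⇔ Any (T ∘ p) xs
T-or p [] = mk⇔ (λ ()) (λ ())
T-or p (x ∷ xs) with p x in eq
... | true  = mk⇔ (λ _ → here (subst T (sym eq) _)) (λ _ → _)
... | false = mk⇔ (there ∘ to (T-or p xs))
  (λ { (here px) → ⊥-elim (subst T eq px) ; (there a) → from (T-or p xs) a })

T-allᶠ : {p : Fin n → Bool} → T (allᶠ n p) ⇔ (∀ i → T (p i))
T-allᶠ {n} {p} = mk⇔ (λ t i → All.lookup (to (T-and p (allFin n)) t) (∈-allFin i))
                     (λ h → from (T-and p (allFin n)) (All.tabulate λ {i} _ → h i))

T-anyᶠ : {p : Fin n → Bool} → T (anyᶠ n p) ⇔ ∃ (T ∘ p)
T-anyᶠ {n} {p} = mk⇔ (Any.satisfied ∘ to (T-or p (allFin n)))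
                     (λ (i , pi) → from (T-or p (allFin n)) (lose (∈-allFin i) pi))

-- Counting

toℕ : Bool → ℕ
toℕ false = 0
toℕ true  = 1

count : (A → Bool) → List A → ℕ
count p xs = length (filterᵇ p xs)

count-∷ : {p : A → Bool} (a : A) (xs : List A) → count p (a ∷ xs) ≡ toℕ (p a) + count p xs
count-∷ {p = p} a xs with p a
... | true  = refl
... | false = refl

module _ {p : A → Bool} where

  count-++ : ∀ xs ys → count p (xs List.++ ys) ≡ count p xs + count p ys
  count-++ xs ys = trans (cong length (filter-++ (T? ∘ p) xs ys)) (length-++ (filterᵇ p xs))

  count-map : ∀ (f : B → A) xs → count p (map f xs) ≡ count (p ∘ f) xs
  count-map f [] = refl
  count-map f (b ∷ xs) = begin
    count p (f b ∷ map f xs)          ≡⟨ count-∷ (f b) (map f xs) ⟩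
    toℕ (p (f b)) + count p (map f xs) ≡⟨ cong (toℕ (p (f b)) +_) (count-map f xs) ⟩
    toℕ (p (f b)) + count (p ∘ f) xs  ≡⟨ count-∷ {p = p ∘ f} b xs ⟨
    count (p ∘ f) (b ∷ xs)            ∎
    where open ≡-Reasoning

  count-concatMap : ∀ (f : B → List A) xs → count p (concatMap f xs) ≡ sum (map (count p ∘ f) xs)
  count-concatMap f [] = refl
  count-concatMap f (b ∷ xs) =
    trans (count-++ (f b) (concatMap f xs)) (cong (count p (f b) +_) (count-concatMap f xs))

  count≡0 : ∀ {xs} → All (¬_ ∘ T ∘ p) xs → count p xs ≡ 0
  count≡0 none = cong length (filter-none (T? ∘ p) none)

  sum-toℕ : ∀ xs → sum (map (toℕ ∘ p) xs) ≡ count p xs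
  sum-toℕ [] = refl
  sum-toℕ (a ∷ xs) = trans (cong (toℕ (p a) +_) (sum-toℕ xs)) (sym (count-∷ a xs))

count-cong : {p q : A → Bool} → p ≗ q → ∀ xs → count p xs ≡ count q xs
count-cong {p = p} {q} eq [] = refl
count-cong {p = p} {q} eq (a ∷ xs) = begin
  count p (a ∷ xs)           ≡⟨ count-∷ a xs ⟩
  toℕ (p a) + count p xs     ≡⟨ cong₂ _+_ (cong toℕ (eq a)) (count-cong eq xs) ⟩
  toℕ (q a) + count q xs     ≡⟨ count-∷ a xs ⟨
  count q (a ∷ xs)           ∎
  where open ≡-Reasoning

count-true : (xs : List A) → count (λ _ → true) xs ≡ length xs
count-true xs = cong length (filter-all (T? ∘ λ _ → true) (All.universal _ xs))

count≡0⇒ : {p : A → Bool} {xs : List A} {a : A} → count p xs ≡ 0 → a ∈ xs → ¬ T (p a)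
count≡0⇒ {p = p} none a∈ pa = nonempty (∈-filter⁺ (T? ∘ p) a∈ pa) none
  where
  nonempty : ∀ {a : A} {zs} → a ∈ zs → ¬ length zs ≡ 0
  nonempty (here _) ()
  nonempty (there _) ()

sum-map-+ : (f g : A → ℕ) (xs : List A) → sum (map (λ a → f a + g a) xs) ≡ sum (map f xs) + sum (map g xs)
sum-map-+ f g [] = refl
sum-map-+ f g (a ∷ xs) =
  trans (cong (f a + g a +_) (sum-map-+ f g xs)) (interchange (f a) (g a) (sum (map f xs)) (sum (map g xs)))

sum-map-*ʳ : (f : A → ℕ) (c : ℕ) (xs : List A) → sum (map (λ a → f a * c) xs) ≡ sum (map f xs) * c
sum-map-*ʳ f c [] = refl
sum-map-*ʳ f c (a ∷ xs) =
  trans (cong (f a * c +_) (sum-map-*ʳ f c xs)) (sym (*-distribʳ-+ c (f a) (sum (map f xs))))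

sum-count-comm : (R : A → B → Bool) (xs : List A) (ys : List B) →
                 sum (map (λ b → count (λ a → R a b) xs) ys) ≡ sum (map (λ a → count (R a) ys) xs)
sum-count-comm R [] ys = sum-map-0 ys
  where
  sum-map-0 : (ys : List B) → sum (map (λ _ → 0) ys) ≡ 0
  sum-map-0 [] = refl
  sum-map-0 (_ ∷ ys) = sum-map-0 ys
sum-count-comm R (a ∷ xs) ys = begin
  sum (map (λ b → count (λ a′ → R a′ b) (a ∷ xs)) ys)
    ≡⟨ cong sum (map-cong (λ b → count-∷ {p = λ a′ → R a′ b} a xs) ys) ⟩
  sum (map (λ b → toℕ (R a b) + count (λ a′ → R a′ b) xs) ys)
    ≡⟨ sum-map-+ (toℕ ∘ R a) _ ys ⟩
  sum (map (toℕ ∘ R a) ys) + sum (map (λ b → count (λ a′ → R a′ b) xs) ys)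
    ≡⟨ cong₂ _+_ (sum-toℕ ys) (sum-count-comm R xs ys) ⟩
  count (R a) ys + sum (map (λ a′ → count (R a′) ys) xs)
    ∎
  where open ≡-Reasoning

count-partition : (P : A → Bool) (Q : A → B → Bool) (xs : List A) (ys : List B) →
                  (∀ a → T (P a) → count (Q a) ys ≡ 1) →
                  count P xs ≡ sum (map (λ b → count (λ a → P a ∧ Q a b) xs) ys)
count-partition P Q xs ys unique = begin
  count P xs                                         ≡⟨ sum-toℕ xs ⟨
  sum (map (toℕ ∘ P) xs)                             ≡⟨ cong sum (map-cong labels xs) ⟩
  sum (map (λ a → count (λ b → P a ∧ Q a b) ys) xs)  ≡⟨ sum-count-comm (λ a b → P a ∧ Q a b) xs ys ⟨
  sum (map (λ b → count (λ a → P a ∧ Q a b) xs) ys)  ∎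
  where
  open ≡-Reasoning
  labels : ∀ a → toℕ (P a) ≡ count (λ b → P a ∧ Q a b) ys
  labels a with P a in eq
  ... | true  = sym (unique a (subst T (sym eq) _))
  ... | false = sym (count≡0 (All.universal (λ _ ()) ys))

count-split : (p q : A → Bool) (xs : List A) →
              count p xs ≡ count (λ a → p a ∧ q a) xs + count (λ a → p a ∧ not (q a)) xs
count-split p q xs = begin
  count p xs                                                       ≡⟨ sum-toℕ xs ⟨
  sum (map (toℕ ∘ p) xs)                                           ≡⟨ cong sum (map-cong split xs) ⟩
  sum (map (λ a → toℕ (p a ∧ q a) + toℕ (p a ∧ not (q a))) xs)     ≡⟨ sum-map-+ _ _ xs ⟩
  sum (map (λ a → toℕ (p a ∧ q a)) xs) + sum (map (λ a → toℕ (p a ∧ not (q a))) xs)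
                                                                   ≡⟨ cong₂ _+_ (sum-toℕ xs) (sum-toℕ xs) ⟩
  count (λ a → p a ∧ q a) xs + count (λ a → p a ∧ not (q a)) xs    ∎
  where
  open ≡-Reasoning
  split : ∀ a → toℕ (p a) ≡ toℕ (p a ∧ q a) + toℕ (p a ∧ not (q a))
  split a with p a | q a
  ... | false | _     = refl
  ... | true  | false = refl
  ... | true  | true  = refl

unique-map⁺ : {f : A → B} {xs : List A} → (∀ {a b} → a ∈ xs → b ∈ xs → f a ≡ f b → a ≡ b) →
              Unique xs → Unique (map f xs)
unique-map⁺ inj [] = []
unique-map⁺ inj (a∉ ∷ u) =
  All.map⁺ (All.tabulate λ b∈ fa≡fb → All.lookup a∉ b∈ (inj (here refl) (there b∈) fa≡fb))
  ∷ unique-map⁺ (λ a∈ b∈ → inj (there a∈) (there b∈)) u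

count-bijection : (p : A → Bool) (q : B → Bool) {xs : List A} {ys : List B} (ψ : B → A) →
                  Unique xs → Unique ys →
                  (∀ {b} → b ∈ ys → T (q b) → ψ b ∈ xs × T (p (ψ b))) →
                  (∀ {b b′} → b ∈ ys → b′ ∈ ys → T (q b) → T (q b′) →
                     ψ b ≡ ψ b′ → b ≡ b′) →
                  (∀ {a} → a ∈ xs → T (p a) → ∃ λ b → b ∈ ys × T (q b) × ψ b ≡ a) →
                  count q ys ≡ count p xs
count-bijection p q {xs} {ys} ψ uxs uys into inj onto = begin
  length (filterᵇ q ys)          ≡⟨ length-map ψ (filterᵇ q ys) ⟨
  length (map ψ (filterᵇ q ys))  ≡⟨ ↭-length (∼bag⇒↭ (unique∧set⇒bag image-unique filter-unique same)) ⟩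
  length (filterᵇ p xs)          ∎
  where
  open ≡-Reasoning
  filter-unique : Unique (filterᵇ p xs)
  filter-unique = Unique.filter⁺ (T? ∘ p) uxs
  image-unique : Unique (map ψ (filterᵇ q ys))
  image-unique = unique-map⁺
    (λ b∈ b′∈ → let b∈ys , qb = ∈-filter⁻ (T? ∘ q) b∈
                    b′∈ys , qb′ = ∈-filter⁻ (T? ∘ q) b′∈
                in inj b∈ys b′∈ys qb qb′)
    (Unique.filter⁺ (T? ∘ q) uys)
  same : ∀ {a} → (a ∈ map ψ (filterᵇ q ys)) ⇔ (a ∈ filterᵇ p xs)
  same = mk⇔
    (λ a∈ → let b , b∈ , a≡ψb = ∈-map⁻ ψ a∈
                b∈ys , qb = ∈-filter⁻ (T? ∘ q) b∈
                ψb∈ , pψb = into b∈ys qb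
            in subst (_∈ filterᵇ p xs) (sym a≡ψb) (∈-filter⁺ (T? ∘ p) ψb∈ pψb))
    (λ a∈ → let a∈xs , pa = ∈-filter⁻ (T? ∘ p) a∈
                b , b∈ , qb , ψb≡a = onto a∈xs pa
            in subst (_∈ map ψ (filterᵇ q ys)) ψb≡a (∈-map⁺ ψ (∈-filter⁺ (T? ∘ q) b∈ qb)))

count≡1 : {p : A → Bool} {xs : List A} {a : A} → Unique xs → a ∈ xs → T (p a) →
          (∀ {b} → b ∈ xs → T (p b) → b ≡ a) → count p xs ≡ 1
count≡1 {p = p} {a = a} uxs a∈ pa only =
  sym (count-bijection p (λ _ → true) {ys = [ a ]} (λ b → b) uxs ([] ∷ [])
  (λ { (here refl) _ → a∈ , pa })
  (λ { (here refl) (here refl) _ _ _ → refl })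
  (λ b∈ pb → a , here refl , _ , sym (only b∈ pb)))

count≡1⇒≡ : {p : A → Bool} {xs : List A} {a b : A} → count p xs ≡ 1 →
            a ∈ xs → T (p a) → b ∈ xs → T (p b) → a ≡ b
count≡1⇒≡ {p = p} one a∈ pa b∈ pb =
  singleton (∈-filter⁺ (T? ∘ p) a∈ pa) (∈-filter⁺ (T? ∘ p) b∈ pb) one
  where
  singleton : ∀ {a b : A} {zs} → a ∈ zs → b ∈ zs → length zs ≡ 1 → a ≡ b
  singleton (here refl) (here refl) _ = refl
  singleton {zs = _ ∷ _ ∷ _} _ _ ()

count-remove : {p : Fin n → Bool} {xs : List (Fin n)} {a : Fin n} → Unique xs → a ∈ xs → T (p a) →
               count p xs ≡ suc (count (λ b → p b ∧ not (b == a)) xs)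
count-remove {p = p} {xs} {a} uxs a∈ pa = trans (count-split p (_== a) xs)
  (cong (_+ count (λ b → p b ∧ not (b == a)) xs)
    (count≡1 uxs a∈ (from T-∧ (pa , from T-== refl)) (λ _ t → to T-== (proj₂ (to T-∧ t)))))

-- Enumerating vectors

allVecs-suc : (xs : List A) (n : ℕ) → allVecs xs (suc n) ≡ cartesianProductWith _∷_ xs (allVecs xs n)
allVecs-suc xs n = prepend-each xs
  where
  prepend-each : ∀ ys → concatMap (λ a → map (a ∷_) (allVecs xs n)) ys
                         ≡ cartesianProductWith _∷_ ys (allVecs xs n)
  prepend-each [] = refl
  prepend-each (a ∷ ys) = cong (map (a ∷_) (allVecs xs n) List.++_) (prepend-each ys)

∈-allVecs : {xs : List A} → (∀ a → a ∈ xs) → (v : Vec A n) → v ∈ allVecs xs n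
∈-allVecs complete [] = here refl
∈-allVecs {xs = xs} complete (a ∷ v) = subst ((a ∷ v) ∈_) (sym (allVecs-suc xs _))
  (∈-cartesianProductWith⁺ _∷_ (complete a) (∈-allVecs complete v))

allVecs⁺ : {xs : List A} → Unique xs → ∀ n → Unique (allVecs xs n)
allVecs⁺ uxs zero = [] ∷ []
allVecs⁺ {xs = xs} uxs (suc n) = subst Unique (sym (allVecs-suc xs n))
  (Unique.cartesianProductWith⁺ _∷_ ∷-injective uxs (allVecs⁺ uxs n))

∈-tuples : (v : Vec (Fin n) m) → v ∈ allVecs (allFin n) m
∈-tuples = ∈-allVecs ∈-allFin

tuples-unique : ∀ n m → Unique (allVecs (allFin n) m)
tuples-unique n = allVecs⁺ (Unique.allFin⁺ n)

∈-allSubsets : (U : Vec Bool n) → U ∈ allSubsets n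
∈-allSubsets = ∈-allVecs λ { true → here refl ; false → there (here refl) }

allSubsets-unique : ∀ n → Unique (allSubsets n)
allSubsets-unique = allVecs⁺ (((λ ()) ∷ []) ∷ [] ∷ [])

lookup-ext : {u v : Vec A n} → (∀ i → lookup u i ≡ lookup v i) → u ≡ v
lookup-ext {u = u} {v} eq = trans (sym (tabulate∘lookup u)) (trans (tabulate-cong eq) (tabulate∘lookup v))

data PunchInView (v : Fin (suc n)) : Fin (suc n) → Set where
  at      : PunchInView v v
  punched : (i : Fin n) → PunchInView v (punchIn v i)

punchInView : (v u : Fin (suc n)) → PunchInView v u
punchInView v u with u ≟ v
... | yes refl = at
... | no u≢v = subst (PunchInView v) (punchIn-punchOut (u≢v ∘ sym)) (punched _)

lookup-removeAt : (xs : Vec A (suc n)) (v : Fin (suc n)) (i : Fin n) →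
                  lookup (removeAt xs v) i ≡ lookup xs (punchIn v i)
lookup-removeAt xs v i =
  trans (cong (lookup (removeAt xs v)) (sym (punchOut-punchIn v))) (removeAt-punchOut xs (punchInᵢ≢i v i ∘ sym))

-- Injective tuples with a prescribed image

module _ {N : ℕ} where

  injectiveᵇ : Vec (Fin N) m → Bool
  injectiveᵇ {m} f = allᶠ m λ i → allᶠ m λ j → (lookup f i == lookup f j) ⇒ᵇ (i == j)

  imageᵇ : Vec (Fin N) m → (Fin N → Bool) → Bool
  imageᵇ {m} f U = allᶠ N λ x → U x ⇔ᵇ anyᶠ m (λ i → lookup f i == x)

  enumeratesᵇ : Vec (Fin N) m → (Fin N → Bool) → Bool
  enumeratesᵇ f U = injectiveᵇ f ∧ imageᵇ f U

  IsImage : Vec (Fin N) m → (Fin N → Bool) → Set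
  IsImage f U = ∀ x → T (U x) ⇔ (∃ λ i → lookup f i ≡ x)

  Enumerates : Vec (Fin N) m → (Fin N → Bool) → Set
  Enumerates f U = Injective _≡_ _≡_ (lookup f) × IsImage f U

  T-injectiveᵇ : {f : Vec (Fin N) m} → T (injectiveᵇ f) ⇔ Injective _≡_ _≡_ (lookup f)
  T-injectiveᵇ {m} {f} = mk⇔ reflect reify
    where
    reflect : T (injectiveᵇ f) → Injective _≡_ _≡_ (lookup f)
    reflect t {i} {j} e = to T-== (to T-⇒ᵇ (to T-allᶠ (to T-allᶠ t i) j) (from T-== e))
    reify : Injective _≡_ _≡_ (lookup f) → T (injectiveᵇ f)
    reify inj = from T-allᶠ λ i → from T-allᶠ λ j →
      from (T-⇒ᵇ {lookup f i == lookup f j}) λ t → from T-== (inj (to T-== t))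

  T-imageᵇ : {f : Vec (Fin N) m} {U : Fin N → Bool} → T (imageᵇ f U) ⇔ IsImage f U
  T-imageᵇ {m} {f} {U} = mk⇔ reflect reify
    where
    reflect : T (imageᵇ f U) → IsImage f U
    reflect t x = mk⇔
      (λ u → let i , e = to T-anyᶠ (subst T Ux≡any u) in i , to T-== e)
      (λ (i , e) → subst T (sym Ux≡any) (from T-anyᶠ (i , from T-== e)))
      where
      Ux≡any : U x ≡ anyᶠ m (λ i → lookup f i == x)
      Ux≡any = to T-⇔ᵇ (to T-allᶠ t x)
    reify : IsImage f U → T (imageᵇ f U)
    reify img = from T-allᶠ λ x → from T-⇔ᵇ (T-injective
      (λ u → let i , e = to (img x) u in from T-anyᶠ (i , from T-== e))
      (λ t → let i , e = to T-anyᶠ t in from (img x) (i , to T-== e)))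

  T-enumeratesᵇ : {f : Vec (Fin N) m} {U : Fin N → Bool} → T (enumeratesᵇ f U) ⇔ Enumerates f U
  T-enumeratesᵇ {f = f} {U} = mk⇔ reflect reify
    where
    reflect : T (enumeratesᵇ f U) → Enumerates f U
    reflect t = let inj , img = to (T-∧ {injectiveᵇ f}) t
                in to (T-injectiveᵇ {f = f}) inj , to (T-imageᵇ {f = f}) img
    reify : Enumerates f U → T (enumeratesᵇ f U)
    reify (inj , img) = from T-∧ (from (T-injectiveᵇ {f = f}) inj , from (T-imageᵇ {f = f}) img)

  _∖_ : (Fin N → Bool) → Fin N → (Fin N → Bool)
  (U ∖ a) b = U b ∧ not (b == a)

  module _ {a : Fin N} {f : Vec (Fin N) m} {U : Fin N → Bool} where

    head∈image : IsImage (a ∷ f) U → T (U a)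
    head∈image img = from (img a) (zero , refl)

    image-∖-avoids : IsImage f (U ∖ a) → ∀ j → lookup f j ≢ a
    image-∖-avoids img j fj≡a =
      to T-not== (proj₂ (to (T-∧ {U a}) (from (img a) (j , fj≡a)))) refl

    enumerates-∷ : T (U a) → Enumerates (a ∷ f) U ⇔ Enumerates f (U ∖ a)
    enumerates-∷ Ua = mk⇔ tail-enumerates cons-enumerates
      where
      tail-enumerates : Enumerates (a ∷ f) U → Enumerates f (U ∖ a)
      tail-enumerates (inj , img) = (λ e → suc-injective (inj e)) , λ b → mk⇔
        (λ t → let Ub , b≢a = to T-∧ t in tail-preimage (to T-not== b≢a) (to (img b) Ub))
        (λ (i , fi≡b) → from T-∧ (from (img b) (suc i , fi≡b) , from T-not== λ b≡a →
          0≢1+n (inj (sym (trans fi≡b b≡a)))))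
        where
        tail-preimage : ∀ {b} → b ≢ a → (∃ λ i → lookup (a ∷ f) i ≡ b) →
                        ∃ λ i → lookup f i ≡ b
        tail-preimage b≢a (zero , a≡b) = ⊥-elim (b≢a (sym a≡b))
        tail-preimage b≢a (suc i , fi≡b) = i , fi≡b

      cons-enumerates : Enumerates f (U ∖ a) → Enumerates (a ∷ f) U
      cons-enumerates (inj , img) = cons-injective , λ b → mk⇔ (cons-preimage b (b ≟ a)) (cons-image b)
        where
        cons-injective : Injective _≡_ _≡_ (lookup (a ∷ f))
        cons-injective {zero}  {zero}  _ = refl
        cons-injective {zero}  {suc j} e = ⊥-elim (image-∖-avoids img j (sym e))
        cons-injective {suc i} {zero}  e = ⊥-elim (image-∖-avoids img i e)
        cons-injective {suc i} {suc j} e = cong suc (inj e)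
        cons-preimage : ∀ b → Dec (b ≡ a) → T (U b) → ∃ λ i → lookup (a ∷ f) i ≡ b
        cons-preimage b (yes refl) _ = zero , refl
        cons-preimage b (no b≢a) Ub =
          let i , fi≡b = to (img b) (from T-∧ (Ub , from T-not== b≢a)) in suc i , fi≡b
        cons-image : ∀ b → (∃ λ i → lookup (a ∷ f) i ≡ b) → T (U b)
        cons-image b (zero , refl) = Ua
        cons-image b (suc i , fi≡b) = proj₁ (to T-∧ (from (img b) (i , fi≡b)))

  count-enumerations : ∀ r (U : Fin N → Bool) → count U (allFin N) ≡ r →
                       count (λ f → enumeratesᵇ f U) (allVecs (allFin N) r) ≡ r !
  count-enumerations zero U none =
    count≡1 {p = λ f → enumeratesᵇ f U} (tuples-unique N 0) (here refl)
      (from (T-enumeratesᵇ {f = []}) []-enumerates) (λ { (here refl) _ → refl })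
    where
    []-enumerates : Enumerates [] U
    []-enumerates = (λ { {()} }) ,
      λ b → mk⇔ (λ Ub → ⊥-elim (count≡0⇒ none (∈-allFin b) Ub)) (λ { (() , _) })
  count-enumerations (suc r) U size = begin
    count E (concatMap (λ a → map (a ∷_) tuples) (allFin N))  ≡⟨ count-concatMap _ (allFin N) ⟩
    sum (map (λ a → count E (map (a ∷_) tuples)) (allFin N))  ≡⟨ cong sum (map-cong by-head (allFin N)) ⟩
    sum (map (λ a → toℕ (U a) * r !) (allFin N))              ≡⟨ sum-map-*ʳ (toℕ ∘ U) (r !) (allFin N) ⟩
    sum (map (toℕ ∘ U) (allFin N)) * r !                      ≡⟨ cong (_* r !) (sum-toℕ (allFin N)) ⟩
    count U (allFin N) * r !                                  ≡⟨ cong (_* r !) size ⟩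
    suc r * r !                                               ∎
    where
    open ≡-Reasoning
    tuples : List (Vec (Fin N) r)
    tuples = allVecs (allFin N) r
    E : Vec (Fin N) (suc r) → Bool
    E f = enumeratesᵇ f U
    by-head : ∀ a → count E (map (a ∷_) tuples) ≡ toℕ (U a) * r !
    by-head a with U a in eq
    ... | false = trans (count-map (a ∷_) tuples) (count≡0 (All.universal
      (λ f t → subst T eq (head∈image (proj₂ (to (T-enumeratesᵇ {f = a ∷ f}) t)))) tuples))
    ... | true = begin
      count E (map (a ∷_) tuples)                     ≡⟨ count-map (a ∷_) tuples ⟩
      count (λ f → enumeratesᵇ (a ∷ f) U) tuples     ≡⟨ count-cong drop-head tuples ⟩
      count (λ f → enumeratesᵇ f (U ∖ a)) tuples     ≡⟨ count-enumerations r (U ∖ a) size-∖ ⟩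
      r !                                             ≡⟨ +-identityʳ (r !) ⟨
      1 * r !                                         ∎
      where
      Ua : T (U a)
      Ua = subst T (sym eq) _
      drop-head : ∀ f → enumeratesᵇ (a ∷ f) U ≡ enumeratesᵇ f (U ∖ a)
      drop-head f = T-injective
        (from (T-enumeratesᵇ {f = f}) ∘ to (enumerates-∷ Ua) ∘ to (T-enumeratesᵇ {f = a ∷ f}))
        (from (T-enumeratesᵇ {f = a ∷ f}) ∘ from (enumerates-∷ Ua) ∘ to (T-enumeratesᵇ {f = f}))
      size-∖ : count (U ∖ a) (allFin N) ≡ r
      size-∖ = ℕ.suc-injective (trans (sym (count-remove (Unique.allFin⁺ N) (∈-allFin a) Ua)) size)

  enumeration-size : {f : Vec (Fin N) m} {U : Fin N → Bool} → Enumerates f U → count U (allFin N) ≡ m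
  enumeration-size {m} {f} {U} (inj , img) = begin
    count U (allFin N)
      ≡⟨ count-bijection U (λ _ → true) (lookup f) (Unique.allFin⁺ N) (Unique.allFin⁺ m) into (λ _ _ _ _ → inj) onto ⟨
    count (λ _ → true) (allFin m)  ≡⟨ count-true (allFin m) ⟩
    length (allFin m)              ≡⟨ length-tabulate _ ⟩
    m                              ∎
    where
    open ≡-Reasoning
    into : ∀ {i} → i ∈ allFin m → T true → lookup f i ∈ allFin N × T (U (lookup f i))
    into _ _ = ∈-allFin _ , from (img _) (_ , refl)
    onto : ∀ {x} → x ∈ allFin N → T (U x) → ∃ λ i → i ∈ allFin m × T true × lookup f i ≡ x
    onto _ Ux = let i , fi≡x = to (img _) Ux in i , ∈-allFin i , _ , fi≡x

  image : Vec (Fin N) m → Vec Bool N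
  image {m} f = tabulate λ x → anyᶠ m (λ i → lookup f i == x)

  imageᵇ-image : (f : Vec (Fin N) m) {U : Vec Bool N} → T (imageᵇ f (lookup U)) ⇔ (U ≡ image f)
  imageᵇ-image {m} f {U} = mk⇔
    (λ t → lookup-ext λ x → trans (to T-⇔ᵇ (to T-allᶠ t x)) (sym (lookup∘tabulate _ x)))
    (λ { refl → from T-allᶠ λ x →
           from T-⇔ᵇ (lookup∘tabulate (λ y → anyᶠ m λ i → lookup f i == y) x) })

-- Cliques and induced complete subgraphs

module _ {N : ℕ} (g : Adj N) where

  cliqueᵇ : Vec (Fin N) m → Bool
  cliqueᵇ {m} f = allᶠ m λ i → allᶠ m λ j → K m i j ⇔ᵇ g (lookup f i) (lookup f j)

  cliqueTupleᵇ : Vec (Fin N) m → Bool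
  cliqueTupleᵇ f = injectiveᵇ f ∧ cliqueᵇ f

  IsClique : Vec (Fin N) m → Set
  IsClique f = ∀ {i j} → i ≢ j → T (g (lookup f i) (lookup f j))

  IsCliqueTuple : Vec (Fin N) m → Set
  IsCliqueTuple f = Injective _≡_ _≡_ (lookup f) × IsClique f

  T-cliqueᵇ : Irreflexive g → {f : Vec (Fin N) m} → T (cliqueᵇ f) ⇔ IsClique f
  T-cliqueᵇ {m} irr {f} = mk⇔ reflect reify
    where
    reflect : T (cliqueᵇ f) → IsClique f
    reflect t {i} {j} i≢j = subst T (to T-⇔ᵇ (to T-allᶠ (to T-allᶠ t i) j)) (from T-not== i≢j)
    reify : IsClique f → T (cliqueᵇ f)
    reify cl = from T-allᶠ λ i → from T-allᶠ λ j → from (T-⇔ᵇ {K m i j}) (T-injective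
      (cl ∘ to T-not==)
      (λ t → from T-not== λ { refl → subst T (irr (lookup f i)) t }))

  T-cliqueTupleᵇ : Irreflexive g → {f : Vec (Fin N) m} → T (cliqueTupleᵇ f) ⇔ IsCliqueTuple f
  T-cliqueTupleᵇ irr {f} = mk⇔ reflect reify
    where
    reflect : T (cliqueTupleᵇ f) → IsCliqueTuple f
    reflect t = let inj , clq = to (T-∧ {injectiveᵇ f}) t
                in to (T-injectiveᵇ {f = f}) inj , to (T-cliqueᵇ irr {f}) clq
    reify : IsCliqueTuple f → T (cliqueTupleᵇ f)
    reify (inj , clq) = from T-∧ (from (T-injectiveᵇ {f = f}) inj , from (T-cliqueᵇ irr {f}) clq)

  clique-by-image : {f f′ : Vec (Fin N) m} {U : Fin N → Bool} →
                    Enumerates f U → Enumerates f′ U → IsClique f → IsClique f′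
  clique-by-image {f = f} {f′} (_ , img) (inj′ , img′) cl {i} {j} i≢j
    with to (img (lookup f′ i)) (from (img′ _) (i , refl)) | to (img (lookup f′ j)) (from (img′ _) (j , refl))
  ... | i₀ , fi₀≡ | j₀ , fj₀≡ = subst T (cong₂ g fi₀≡ fj₀≡)
        (cl λ { refl → i≢j (inj′ (trans (sym fi₀≡) fj₀≡)) })

  T-inducedIso-K : Irreflexive g → {U : Vec Bool N} →
                   T (inducedIso g (K m) U) ⇔ (∃ λ f → Enumerates f (lookup U) × IsClique f)
  T-inducedIso-K {m} irr {U} = mk⇔ reflect reify
    where
    ok : Vec (Fin N) m → Bool
    ok f = injectiveᵇ f ∧ imageᵇ f (lookup U) ∧ cliqueᵇ f
    reflect : T (inducedIso g (K m) U) → ∃ λ f → Enumerates f (lookup U) × IsClique f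
    reflect t = let f , ok-f = Any.satisfied (to (T-or ok (allVecs (allFin N) m)) t)
                    inj , img-clq = to (T-∧ {injectiveᵇ f}) ok-f
                    img , clq = to (T-∧ {imageᵇ f (lookup U)}) img-clq
                in f , (to (T-injectiveᵇ {f = f}) inj , to (T-imageᵇ {f = f}) img) , to (T-cliqueᵇ irr {f}) clq
    reify : (∃ λ f → Enumerates f (lookup U) × IsClique f) → T (inducedIso g (K m) U)
    reify (f , (inj , img) , cl) = from (T-or ok (allVecs (allFin N) m)) (lose (∈-tuples f)
      (from T-∧ (from (T-injectiveᵇ {f = f}) inj ,
                 from T-∧ (from (T-imageᵇ {f = f}) img , from (T-cliqueᵇ irr {f}) cl))))

  count-clique-enumerations : Irreflexive g → ∀ r (U : Vec Bool N) →
                              count (λ f → cliqueTupleᵇ f ∧ imageᵇ f (lookup U)) (allVecs (allFin N) r)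
                                ≡ toℕ (inducedIso g (K r) U) * r !
  count-clique-enumerations irr r U with inducedIso g (K r) U in eq
  ... | false = count≡0 (All.universal (λ f t → subst T eq (from (T-inducedIso-K irr {U = U}) (f , reflect f t)))
                                       (allVecs (allFin N) r))
    where
    reflect : ∀ f → T (cliqueTupleᵇ f ∧ imageᵇ f (lookup U)) → Enumerates f (lookup U) × IsClique f
    reflect f t = let inj-clq , img = to (T-∧ {cliqueTupleᵇ f}) t
                      inj , clq = to (T-cliqueTupleᵇ irr {f}) inj-clq
                  in (inj , to (T-imageᵇ {f = f}) img) , clq
  ... | true = begin
    count (λ f → cliqueTupleᵇ f ∧ imageᵇ f (lookup U)) tuples  ≡⟨ count-cong forget-clique tuples ⟩
    count (λ f → enumeratesᵇ f (lookup U)) tuples              ≡⟨ count-enumerations r (lookup U) size ⟩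
    r !                                                        ≡⟨ +-identityʳ (r !) ⟨
    1 * r !                                                    ∎
    where
    open ≡-Reasoning
    tuples : List (Vec (Fin N) r)
    tuples = allVecs (allFin N) r
    witness : ∃ λ f → Enumerates f (lookup U) × IsClique f
    witness = to (T-inducedIso-K irr {U = U}) (subst T (sym eq) _)
    f₀ : Vec (Fin N) r
    f₀ = proj₁ witness
    size : count (lookup U) (allFin N) ≡ r
    size = enumeration-size {f = f₀} (proj₁ (proj₂ witness))
    forget-clique : ∀ f → cliqueTupleᵇ f ∧ imageᵇ f (lookup U) ≡ enumeratesᵇ f (lookup U)
    forget-clique f = T-injective
      (λ t → let inj-clq , img = to (T-∧ {cliqueTupleᵇ f}) t
             in from T-∧ (proj₁ (to (T-∧ {injectiveᵇ f}) inj-clq) , img))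
      (λ t → let e = to (T-enumeratesᵇ {f = f}) t
                 clq = clique-by-image {f = f₀} {f} (proj₁ (proj₂ witness)) e (proj₂ (proj₂ witness))
             in from T-∧ (from (T-cliqueTupleᵇ irr {f}) (proj₁ e , clq) ,
                          proj₂ (to (T-∧ {injectiveᵇ f}) t)))

  count-clique-tuples : Irreflexive g → ∀ r →
                        count cliqueTupleᵇ (allVecs (allFin N) r) ≡ r ! * count (inducedIso g (K r)) (allSubsets N)
  count-clique-tuples irr r = begin
    count cliqueTupleᵇ tuples
      ≡⟨ count-partition cliqueTupleᵇ (λ f U → imageᵇ f (lookup U)) tuples subsets unique-image ⟩
    sum (map (λ U → count (λ f → cliqueTupleᵇ f ∧ imageᵇ f (lookup U)) tuples) subsets)
      ≡⟨ cong sum (map-cong (count-clique-enumerations irr r) subsets) ⟩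
    sum (map (λ U → toℕ (iso U) * r !) subsets)  ≡⟨ sum-map-*ʳ (toℕ ∘ iso) (r !) subsets ⟩
    sum (map (toℕ ∘ iso) subsets) * r !          ≡⟨ cong (_* r !) (sum-toℕ subsets) ⟩
    count iso subsets * r !                      ≡⟨ *-comm _ (r !) ⟩
    r ! * count iso subsets                      ∎
    where
    open ≡-Reasoning
    tuples : List (Vec (Fin N) r)
    tuples = allVecs (allFin N) r
    subsets : List (Vec Bool N)
    subsets = allSubsets N
    iso : Vec Bool N → Bool
    iso = inducedIso g (K r)
    unique-image : ∀ f → T (cliqueTupleᵇ f) → count (λ U → imageᵇ f (lookup U)) subsets ≡ 1
    unique-image f _ = count≡1 (allSubsets-unique N) (∈-allSubsets (image f)) (from (imageᵇ-image f) refl)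
      (λ _ t → to (imageᵇ-image f) t)

-- Vectors at Hamming distance at most one

module _ {k : ℕ} where

  DifferAtMostOnce : (c c′ : Vec (Fin k) n) → Set
  DifferAtMostOnce c c′ = ∀ {u w} → lookup c u ≢ lookup c′ u → lookup c w ≢ lookup c′ w → u ≡ w

  differAtMostOnce-refl : {c : Vec (Fin k) n} → DifferAtMostOnce c c
  differAtMostOnce-refl c≢c = ⊥-elim (c≢c refl)

  differInOne⇒differAtMostOnce : {c c′ : Vec (Fin k) n} → T (differInOne c c′) → DifferAtMostOnce c c′
  differInOne⇒differAtMostOnce one d₁ d₂ =
    count≡1⇒≡ (≡ᵇ⇒≡ _ 1 one) (∈-allFin _) (from T-not== d₁) (∈-allFin _) (from T-not== d₂)

  agree-off : {c c₀ c₁ : Vec (Fin k) n} {u v : Fin n} →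
              DifferAtMostOnce c c₀ → DifferAtMostOnce c c₁ → DifferAtMostOnce c₀ c₁ →
              lookup c₀ v ≢ lookup c₁ v → u ≢ v → lookup c u ≡ lookup c₀ u
  -- If c differed from c₀ at u ≠ v, it would agree with c₀ at v and so differ from c₁ at both u and v.
  agree-off {c = c} {c₀} {c₁} {u} {v} c~c₀ c~c₁ c₀~c₁ c₀≢c₁ u≢v =
    decidable-stable (_ ≟ _) λ cu≢c₀u → u≢v (c~c₁ (cu≢c₁u cu≢c₀u) (cv≢c₁v cu≢c₀u))
    where
    c₀u≡c₁u : lookup c₀ u ≡ lookup c₁ u
    c₀u≡c₁u = decidable-stable (_ ≟ _) λ d → u≢v (c₀~c₁ d c₀≢c₁)
    cu≢c₁u : lookup c u ≢ lookup c₀ u → lookup c u ≢ lookup c₁ u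
    cu≢c₁u cu≢c₀u e = cu≢c₀u (trans e (sym c₀u≡c₁u))
    cv≢c₁v : lookup c u ≢ lookup c₀ u → lookup c v ≢ lookup c₁ v
    cv≢c₁v cu≢c₀u = c₀≢c₁ ∘ trans (sym (decidable-stable (_ ≟ _) λ d → u≢v (c~c₀ cu≢c₀u d)))

  differInOne-insertAt : (b : Vec (Fin k) n) (v : Fin (suc n)) {x y : Fin k} → x ≢ y →
                         T (differInOne (insertAt b v x) (insertAt b v y))
  differInOne-insertAt b v {x} {y} x≢y = ≡⇒≡ᵇ _ 1 (count≡1 (Unique.allFin⁺ _) (∈-allFin v)
    (from T-not== (subst₂ _≢_ (sym (insertAt-lookup b v x)) (sym (insertAt-lookup b v y)) x≢y))
    (λ {u} _ d → only-at-v u (punchInView v u) (to T-not== d)))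
    where
    only-at-v : ∀ u → PunchInView v u → lookup (insertAt b v x) u ≢ lookup (insertAt b v y) u → u ≡ v
    only-at-v _ at _ = refl
    only-at-v _ (punched i) d = ⊥-elim (d (trans (insertAt-punchIn b v x i) (sym (insertAt-punchIn b v y i))))

-- Proper colorings and the graph G_v

lookup-injective : {xs : List A} → Unique xs → Injective _≡_ _≡_ (List.lookup xs)
lookup-injective {xs = _ ∷ _} (_ ∷ _) {zero} {zero} _ = refl
lookup-injective {xs = _ ∷ _} (x∉ ∷ _) {zero} {suc j} e = ⊥-elim (All.lookup x∉ (∈-lookup j) e)
lookup-injective {xs = _ ∷ _} (x∉ ∷ _) {suc i} {zero} e = ⊥-elim (All.lookup x∉ (∈-lookup i) (sym e))
lookup-injective {xs = _ ∷ _} (_ ∷ u) {suc i} {suc j} e = cong suc (lookup-injective u e)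

module _ {n k : ℕ} (a : Adj n) where

  IsProper : Vec (Fin k) n → Set
  IsProper c = ∀ {u w} → T (a u w) → lookup c u ≢ lookup c w

  T-isProper : {c : Vec (Fin k) n} → T (isProper a c) ⇔ IsProper c
  T-isProper {c} = mk⇔ reflect reify
    where
    reflect : T (isProper a c) → IsProper c
    reflect t {u} {w} auw = to T-not== (to T-⇒ᵇ (to T-allᶠ (to T-allᶠ t u) w) auw)
    reify : IsProper c → T (isProper a c)
    reify proper = from T-allᶠ λ u → from T-allᶠ λ w → from (T-⇒ᵇ {a u w}) (from T-not== ∘ proper)

  coloring : Fin (chrom a k) → Vec (Fin k) n
  coloring = List.lookup (properColorings a k)

  coloring-injective : Injective _≡_ _≡_ coloring
  coloring-injective = lookup-injective (Unique.filter⁺ (T? ∘ isProper a) (tuples-unique k n))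

  coloring-proper : ∀ x → IsProper (coloring x)
  coloring-proper x =
    to (T-isProper {coloring x}) (proj₂ (∈-filter⁻ (T? ∘ isProper a) {xs = allMaps n k} (∈-lookup x)))

  coloring-surjective : {c : Vec (Fin k) n} → IsProper c → ∃ λ x → coloring x ≡ c
  coloring-surjective {c} proper = Any.index c∈ , sym (lookup-index c∈)
    where
    c∈ : c ∈ properColorings a k
    c∈ = ∈-filter⁺ (T? ∘ isProper a) (∈-tuples _) (from (T-isProper {c}) proper)

module _ {n′ : ℕ} (a : Adj (suc n′)) (v : Fin (suc n′)) where

  Gv⊎ : (r : ℕ) → Fin n′ ⊎ Fin r → Fin n′ ⊎ Fin r → Bool
  Gv⊎ r (inj₁ i) (inj₁ j) = a (punchIn v i) (punchIn v j)
  Gv⊎ r (inj₁ i) (inj₂ _) = a (punchIn v i) v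
  Gv⊎ r (inj₂ _) (inj₁ j) = a v (punchIn v j)
  Gv⊎ r (inj₂ i) (inj₂ j) = not (i == j)

  Gv-splitAt : ∀ r x y → Gv a v r x y ≡ Gv⊎ r (splitAt n′ x) (splitAt n′ y)
  Gv-splitAt r x y with splitAt n′ x | splitAt n′ y
  ... | inj₁ _ | inj₁ _ = refl
  ... | inj₁ _ | inj₂ _ = refl
  ... | inj₂ _ | inj₁ _ = refl
  ... | inj₂ _ | inj₂ _ = refl

  IsProper⊎ : ∀ {k} r → (Fin n′ ⊎ Fin r → Fin k) → Set
  IsProper⊎ r c = ∀ {s s′} → T (Gv⊎ r s s′) → c s ≢ c s′

  Gv-proper⊎ : ∀ {k r} {b : Vec (Fin k) n′} {t : Vec (Fin k) r} →
               IsProper (Gv a v r) (b ++ t) ⇔ IsProper⊎ r [ lookup b , lookup t ]′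
  Gv-proper⊎ {k} {r} {b} {t} = mk⇔
    (λ proper {s} {s′} e → subst₂ _≢_ (on-join s) (on-join s′) (proper (subst T (sym (Gv-join s s′)) e)))
    (λ proper {x} {y} e → subst₂ _≢_ (sym (lookup-splitAt n′ b t x)) (sym (lookup-splitAt n′ b t y))
      (proper {splitAt n′ x} {splitAt n′ y} (subst T (Gv-splitAt r x y) e)))
    where
    on-join : ∀ s → lookup (b ++ t) (join n′ r s) ≡ [ lookup b , lookup t ]′ s
    on-join s = trans (lookup-splitAt n′ b t (join n′ r s)) (cong [ lookup b , lookup t ]′ (splitAt-join n′ r s))
    Gv-join : ∀ s s′ → Gv a v r (join n′ r s) (join n′ r s′) ≡ Gv⊎ r s s′
    Gv-join s s′ = trans (Gv-splitAt r _ _) (cong₂ (Gv⊎ r) (splitAt-join n′ r s) (splitAt-join n′ r s′))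

  Gv-proper : Irreflexive a → ∀ {k r} {b : Vec (Fin k) n′} {t : Vec (Fin k) (suc r)} →
              IsProper (Gv a v (suc r)) (b ++ t) ⇔
              ((∀ j → IsProper a (insertAt b v (lookup t j))) × Injective _≡_ _≡_ (lookup t))
  Gv-proper irr {k} {r} {b} {t} = mk⇔ (split ∘ to (Gv-proper⊎ {b = b} {t})) (from (Gv-proper⊎ {b = b} {t}) ∘ merge)
    where
    w : Fin (suc r) → Vec (Fin k) (suc n′)
    w j = insertAt b v (lookup t j)
    w-old : ∀ j i → lookup (w j) (punchIn v i) ≡ lookup b i
    w-old j i = insertAt-punchIn b v _ i
    w-new : ∀ j → lookup (w j) v ≡ lookup t j
    w-new j = insertAt-lookup b v _

    split : IsProper⊎ (suc r) [ lookup b , lookup t ]′ → (∀ j → IsProper a (w j)) × Injective _≡_ _≡_ (lookup t)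
    split proper = (λ j {u} {u′} → by-view j (punchInView v u) (punchInView v u′)) , injective
      where
      by-view : ∀ j {u u′} → PunchInView v u → PunchInView v u′ → T (a u u′) →
                lookup (w j) u ≢ lookup (w j) u′
      by-view j at at e = ⊥-elim (subst T (irr v) e)
      by-view j at (punched i) e = subst₂ _≢_ (sym (w-new j)) (sym (w-old j i)) (proper {inj₂ j} {inj₁ i} e)
      by-view j (punched i) at e = subst₂ _≢_ (sym (w-old j i)) (sym (w-new j)) (proper {inj₁ i} {inj₂ j} e)
      by-view j (punched i) (punched i′) e =
        subst₂ _≢_ (sym (w-old j i)) (sym (w-old j i′)) (proper {inj₁ i} {inj₁ i′} e)
      injective : Injective _≡_ _≡_ (lookup t)
      injective {j} {j′} e =
        decidable-stable (j ≟ j′) λ j≢j′ → proper {inj₂ j} {inj₂ j′} (from T-not== j≢j′) e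

    merge : (∀ j → IsProper a (w j)) × Injective _≡_ _≡_ (lookup t) → IsProper⊎ (suc r) [ lookup b , lookup t ]′
    merge (proper , _)   {inj₁ i} {inj₁ i′} e = subst₂ _≢_ (w-old zero i) (w-old zero i′) (proper zero e)
    merge (proper , _)   {inj₁ i} {inj₂ j}  e = subst₂ _≢_ (w-old j i) (w-new j) (proper j e)
    merge (proper , _)   {inj₂ j} {inj₁ i}  e = subst₂ _≢_ (w-new j) (w-old j i) (proper j e)
    merge (_      , inj) {inj₂ j} {inj₂ j′} e = to T-not== e ∘ inj

-- Clique tuples of the coloring graph

differsAtᵇ : {k : ℕ} → Vec (Fin k) n → Vec (Fin k) n → Fin n → Bool
differsAtᵇ c c′ u = not (lookup c u == lookup c′ u)

colGraph-irreflexive : {n k : ℕ} (a : Adj n) → Irreflexive (colGraph a k)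
colGraph-irreflexive {n} a x =
  cong (_≡ᵇ 1) (count≡0 {p = differsAtᵇ c c} (All.universal (λ _ d → to T-not== d refl) (allFin n)))
  where c = coloring a x

splitsAtᵇ : {n : ℕ} (a : Adj n) (k : ℕ) → Vec (Fin (chrom a k)) (suc (suc m)) → Fin n → Bool
splitsAtᵇ a k f = differsAtᵇ (coloring a (lookup f zero)) (coloring a (lookup f (suc zero)))

cliqueSplitAtᵇ : {n : ℕ} (a : Adj n) (k : ℕ) → Fin n → Vec (Fin (chrom a k)) (suc (suc m)) → Bool
cliqueSplitAtᵇ a k v f = cliqueTupleᵇ (colGraph a k) f ∧ splitsAtᵇ a k f v

module _ {n′ k : ℕ} (a : Adj (suc n′)) (irr : Irreflexive a) (v : Fin (suc n′)) (r : ℕ) where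

  private
    N R : ℕ
    N = chrom a k
    R = suc (suc r)
    col : Fin N → Vec (Fin k) (suc n′)
    col = coloring a

  IsCliqueSplitAt : Vec (Fin N) R → Set
  IsCliqueSplitAt f = IsCliqueTuple (colGraph a k) f
                    × lookup (col (lookup f zero)) v ≢ lookup (col (lookup f (suc zero))) v

  base : Vec (Fin N) R → Vec (Fin k) n′
  base f = removeAt (col (lookup f zero)) v

  clones : Vec (Fin N) R → Vec (Fin k) R
  clones f = Vec.map (λ x → lookup (col x) v) f

  cloneColoring : Vec (Fin N) R → Vec (Fin k) (n′ + R)
  cloneColoring f = base f ++ clones f

  clique-columns : {f : Vec (Fin N) R} → IsCliqueSplitAt f →
                   ∀ j → col (lookup f j) ≡ insertAt (base f) v (lookup (clones f) j)
  clique-columns {f} ((_ , clique) , split) j = lookup-ext λ u → by-view (punchInView v u)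
    where
    c : Fin R → Vec (Fin k) (suc n′)
    c j = col (lookup f j)
    near : ∀ i j → DifferAtMostOnce (c i) (c j)
    near i j with i ≟ j
    ... | yes refl = differAtMostOnce-refl {c = c i}
    ... | no i≢j = differInOne⇒differAtMostOnce {c = c i} {c j} (clique i≢j)
    by-view : ∀ {u} → PunchInView v u → lookup (c j) u ≡ lookup (insertAt (base f) v (lookup (clones f) j)) u
    by-view at = begin
      lookup (c j) v                                        ≡⟨ lookup-map j _ f ⟨
      lookup (clones f) j                                   ≡⟨ insertAt-lookup (base f) v _ ⟨
      lookup (insertAt (base f) v (lookup (clones f) j)) v  ∎
      where open ≡-Reasoning
    by-view (punched i) = begin
      lookup (c j) (punchIn v i)
        ≡⟨ agree-off {c = c j} {c zero} {c (suc zero)} (near j zero) (near j (suc zero)) (near zero (suc zero))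
                     split (punchInᵢ≢i v i) ⟩
      lookup (c zero) (punchIn v i)                                       ≡⟨ lookup-removeAt (c zero) v i ⟨
      lookup (base f) i                                                   ≡⟨ insertAt-punchIn (base f) v _ i ⟨
      lookup (insertAt (base f) v (lookup (clones f) j)) (punchIn v i)    ∎
      where open ≡-Reasoning

  clones-injective : {f : Vec (Fin N) R} → IsCliqueSplitAt f → Injective _≡_ _≡_ (lookup (clones f))
  clones-injective {f} sf@((inj , _) , _) {i} {j} e = inj (coloring-injective a (begin
    col (lookup f i)                                ≡⟨ clique-columns {f} sf i ⟩
    insertAt (base f) v (lookup (clones f) i)       ≡⟨ cong (insertAt (base f) v) e ⟩
    insertAt (base f) v (lookup (clones f) j)       ≡⟨ clique-columns {f} sf j ⟨
    col (lookup f j)                                ∎))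
    where open ≡-Reasoning

  cloneColoring-proper : {f : Vec (Fin N) R} → IsCliqueSplitAt f → IsProper (Gv a v R) (cloneColoring f)
  cloneColoring-proper {f} sf = from (Gv-proper a v irr)
    ((λ j → subst (IsProper a) (clique-columns {f} sf j) (coloring-proper a (lookup f j))) , clones-injective {f} sf)

  cloneColoring-injective : {f f′ : Vec (Fin N) R} → IsCliqueSplitAt f → IsCliqueSplitAt f′ →
                            cloneColoring f ≡ cloneColoring f′ → f ≡ f′
  cloneColoring-injective {f} {f′} sf sf′ e = lookup-ext λ j → coloring-injective a (begin
    col (lookup f j)                            ≡⟨ clique-columns {f} sf j ⟩
    insertAt (base f) v (lookup (clones f) j)   ≡⟨ cong₂ (λ b t → insertAt b v (lookup t j)) base≡ clones≡ ⟩
    insertAt (base f′) v (lookup (clones f′) j) ≡⟨ clique-columns {f′} sf′ j ⟨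
    col (lookup f′ j)                           ∎)
    where
    open ≡-Reasoning
    base≡ : base f ≡ base f′
    base≡ = proj₁ (++-injective (base f) (base f′) e)
    clones≡ : clones f ≡ clones f′
    clones≡ = proj₂ (++-injective (base f) (base f′) e)

  cloneColoring-surjective : {c : Vec (Fin k) (n′ + R)} → IsProper (Gv a v R) c →
                             ∃ λ f → IsCliqueSplitAt f × cloneColoring f ≡ c
  cloneColoring-surjective {c} proper with Vec.splitAt n′ c
  ... | b , t , refl = f , ((f-injective , f-clique) , f-split) , cong₂ _++_ base-f clones-f
    where
    parts : (∀ j → IsProper a (insertAt b v (lookup t j))) × Injective _≡_ _≡_ (lookup t)
    parts = to (Gv-proper a v irr) proper
    w : Fin R → Vec (Fin k) (suc n′)
    w j = insertAt b v (lookup t j)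
    vertex : Fin R → Fin N
    vertex j = proj₁ (coloring-surjective a (proj₁ parts j))
    f : Vec (Fin N) R
    f = tabulate vertex
    col-f : ∀ j → col (lookup f j) ≡ w j
    col-f j = trans (cong col (lookup∘tabulate vertex j)) (proj₂ (coloring-surjective a (proj₁ parts j)))
    at-v : ∀ j → lookup (col (lookup f j)) v ≡ lookup t j
    at-v j = trans (cong (λ c → lookup c v) (col-f j)) (insertAt-lookup b v _)
    f-injective : Injective _≡_ _≡_ (lookup f)
    f-injective {i} {j} e = proj₂ parts (trans (sym (at-v i)) (trans (cong (λ y → lookup (col y) v) e) (at-v j)))
    f-clique : IsClique (colGraph a k) f
    f-clique {i} {j} i≢j =
      subst T (sym (cong₂ differInOne (col-f i) (col-f j))) (differInOne-insertAt b v (i≢j ∘ proj₂ parts))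
    f-split : lookup (col (lookup f zero)) v ≢ lookup (col (lookup f (suc zero))) v
    f-split e = 0≢1+n (proj₂ parts (trans (sym (at-v zero)) (trans e (at-v (suc zero)))))
    base-f : base f ≡ b
    base-f = trans (cong (λ c → removeAt c v) (col-f zero)) (removeAt-insertAt b v _)
    clones-f : clones f ≡ t
    clones-f = lookup-ext λ j → trans (lookup-map j _ f) (at-v j)

  T-cliqueSplitAtᵇ : {f : Vec (Fin N) R} → T (cliqueSplitAtᵇ a k v f) ⇔ IsCliqueSplitAt f
  T-cliqueSplitAtᵇ {f} = mk⇔ reflect reify
    where
    T-cliqueTuple : T (cliqueTupleᵇ (colGraph a k) f) ⇔ IsCliqueTuple (colGraph a k) f
    T-cliqueTuple = T-cliqueTupleᵇ (colGraph a k) (colGraph-irreflexive {k = k} a) {f}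
    reflect : T (cliqueSplitAtᵇ a k v f) → IsCliqueSplitAt f
    reflect t = let ct , d = to (T-∧ {cliqueTupleᵇ (colGraph a k) f}) t in to T-cliqueTuple ct , to T-not== d
    reify : IsCliqueSplitAt f → T (cliqueSplitAtᵇ a k v f)
    reify (ct , d) = from T-∧ (from T-cliqueTuple ct , from T-not== d)

  count-cliqueSplitAt : count (cliqueSplitAtᵇ a k v) (allVecs (allFin N) R) ≡ chrom (Gv a v R) k
  count-cliqueSplitAt = count-bijection (isProper (Gv a v R)) (cliqueSplitAtᵇ a k v) cloneColoring
    (tuples-unique k (n′ + R)) (tuples-unique N R) into
    (λ {f} {f′} _ _ t t′ → cloneColoring-injective {f} {f′} (reflect {f} t) (reflect {f′} t′)) onto
    where
    reflect : ∀ {f} → T (cliqueSplitAtᵇ a k v f) → IsCliqueSplitAt f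
    reflect {f} = to (T-cliqueSplitAtᵇ {f})
    into : ∀ {f} → f ∈ allVecs (allFin N) R → T (cliqueSplitAtᵇ a k v f) →
           cloneColoring f ∈ allMaps (n′ + R) k × T (isProper (Gv a v R) (cloneColoring f))
    into {f} _ t = ∈-tuples _ ,
      from (T-isProper (Gv a v R) {cloneColoring f}) (cloneColoring-proper {f} (reflect {f} t))
    onto : ∀ {c} → c ∈ allMaps (n′ + R) k → T (isProper (Gv a v R) c) →
           ∃ λ f → f ∈ allVecs (allFin N) R × T (cliqueSplitAtᵇ a k v f) × cloneColoring f ≡ c
    onto {c} _ t = let f , sf , e = cloneColoring-surjective (to (T-isProper (Gv a v R) {c}) t)
                   in f , ∈-tuples f , from (T-cliqueSplitAtᵇ {f}) sf , e

lemma2p3 : (n : ℕ) (a : Adj n) → Symmetric a → Irreflexive a →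
           (r : ℕ) → 2 ≤ r → (k : ℕ) → 1 ≤ k →
           (r !) * chromH a (K r) k
             ≡ sum (map (λ v → chrom (Gv a v r) k) (allFin n))
lemma2p3 n a _ irr (suc (suc r)) _ k _ = begin
  R ! * chromH a (K R) k
    ≡⟨ count-clique-tuples g (colGraph-irreflexive a) R ⟨
  count (cliqueTupleᵇ g) tuples
    ≡⟨ count-partition (cliqueTupleᵇ g) (splitsAtᵇ a k) tuples (allFin n) splits-once ⟩
  sum (map (λ v → count (cliqueSplitAtᵇ a k v) tuples) (allFin n))
    ≡⟨ cong sum (map-cong (per-vertex a irr) (allFin n)) ⟩
  sum (map (λ v → chrom (Gv a v R) k) (allFin n))
    ∎
  where
  open ≡-Reasoning
  R : ℕ
  R = suc (suc r)
  g : Adj (chrom a k)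
  g = colGraph a k
  tuples : List (Vec (Fin (chrom a k)) R)
  tuples = allVecs (allFin (chrom a k)) R
  splits-once : ∀ f → T (cliqueTupleᵇ g f) → count (splitsAtᵇ a k f) (allFin n) ≡ 1
  splits-once f t = ≡ᵇ⇒≡ _ 1 (proj₂ (to (T-cliqueTupleᵇ g (colGraph-irreflexive a) {f}) t) 0≢1+n)
  per-vertex : ∀ {n} (a : Adj n) → Irreflexive a → ∀ v →
               count (cliqueSplitAtᵇ a k v) (allVecs (allFin (chrom a k)) R) ≡ chrom (Gv a v R) k
  per-vertex {suc _} a irr v = count-cliqueSplitAt a irr v r
lemma2p3 _ _ _ _ (suc zero) (s≤s ()) _ _
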